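{- Let $k,r$ be positive integers. Suppose $G$ is a group with symmetric generating set $S$ containing the identity, and $X\subseteq S^k$ and $U\subseteq G$ satisfy $S^{r+k}\subseteq XU$. Then $S^{mr+k}\subseteq XU^m$ for all positive integers $m$.
   Context: For a set $S$ and integer $j\ge1$, $S^j=\{s_1\cdots s_j:s_i\in S\}$; $XU^m=\{xw:x\in X,w\in U^m\}$. A set is symmetric if it equals its set of inverses. -}

module Defs where

open import Level using (Level; _⊔_)
open import Algebra.Bundles using (Group)
open import Data.Nat using (ℕ)
open import Data.Vec using (Vec; []; _∷_; foldr)
open import Data.Vec.Relation.Unary.All using (All)
open import Data.Product using (Σ; ∃; _×_; _,_)
open import Data.Sum using (_⊎_)
open import Relation.Unary using (Pred)

module GroupSets {c ℓ : Level} (G : Group c ℓ) where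
  open Group G

  prod : {j : ℕ} → Vec Carrier j → Carrier
  prod = foldr _ _∙_ ε

  Pow : {p : Level} → Pred Carrier p → ℕ → Pred Carrier (c ⊔ ℓ ⊔ p)
  Pow S j g = Σ (Vec Carrier j) λ v → All S v × prod v ≈ g

  Mul : {p q : Level} → Pred Carrier p → Pred Carrier q → Pred Carrier (c ⊔ ℓ ⊔ p ⊔ q)
  Mul X Y g = Σ Carrier λ x → Σ Carrier λ y → X x × Y y × (x ∙ y) ≈ g

  Symmetric : {p : Level} → Pred Carrier p → Set (c ⊔ ℓ ⊔ p)
  Symmetric S = (∀ s → S s → S (s ⁻¹)) × (∀ s → S s → Σ Carrier λ t → S t × (t ⁻¹) ≈ s)

  Generates : {p : Level} → Pred Carrier p → Set (c ⊔ ℓ ⊔ p)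
  Generates S = ∀ g → ∃ λ (n : ℕ) → Pow (λ s → S s ⊎ S (s ⁻¹)) n g

  _⊆_ : {p q : Level} → Pred Carrier p → Pred Carrier q → Set (c ⊔ p ⊔ q)
  A ⊆ B = ∀ g → A g → B g

-- If g ∈ S^((m+1)r + k), peel off a prefix s ∈ S^r: by induction the rest is x w with
-- x ∈ X ⊆ S^k and w ∈ U^m, and s x ∈ S^(r+k) ⊆ X U rewrites as x' u', so g = x' (u' w).
-- Only X ⊆ S^k and S^(r+k) ⊆ X U are needed; the other hypotheses are unused.
module Submission where

open import Defs
open import Level using (Level)
open import Algebra.Bundles using (Group)
open import Data.Nat using (ℕ; _+_; _*_; NonZero; suc)
open import Data.Nat.Properties using (+-assoc)
open import Data.Product using (_,_)
open import Data.Vec using (Vec; []; _∷_; _++_; splitAt)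
open import Data.Vec.Relation.Unary.All using ([]; _∷_)
open import Data.Vec.Relation.Unary.All.Properties using (++⁺; ++⁻)
open import Relation.Binary.PropositionalEquality as ≡ using (_≡_; subst)
open import Relation.Unary using (Pred)

module PowProperties {c ℓ : Level} (G : Group c ℓ) where
  open Group G
  open GroupSets G
  open import Relation.Binary.Reasoning.Setoid setoid

  prod-++ : ∀ {a b} (xs : Vec Carrier a) (ys : Vec Carrier b) →
            prod (xs ++ ys) ≈ prod xs ∙ prod ys
  prod-++ []       ys = sym (identityˡ (prod ys))
  prod-++ (x ∷ xs) ys = trans (∙-congˡ (prod-++ xs ys)) (sym (assoc x (prod xs) (prod ys)))

  module _ {p : Level} {S : Pred Carrier p} where

    Pow-cast : ∀ {a b g} → a ≡ b → Pow S a g → Pow S b g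
    Pow-cast {g = g} a≡b = subst (λ j → Pow S j g) a≡b

    Pow-one : ∀ {g} → S g → Pow S 1 g
    Pow-one {g} sg = g ∷ [] , sg ∷ [] , identityʳ g

    Pow-∙ : ∀ {a b g h} → Pow S a g → Pow S b h → Pow S (a + b) (g ∙ h)
    Pow-∙ (v , sv , e) (w , sw , f) = v ++ w , ++⁺ sv sw , trans (prod-++ v w) (∙-cong e f)

    Pow-split : ∀ a {b g} → Pow S (a + b) g → Mul (Pow S a) (Pow S b) g
    Pow-split a (v , sv , e) with splitAt a v
    ... | v₁ , v₂ , ≡.refl with ++⁻ v₁ sv
    ...   | sv₁ , sv₂ = prod v₁ , prod v₂ , (v₁ , sv₁ , refl) , (v₂ , sv₂ , refl) ,
                        trans (sym (prod-++ v₁ v₂)) e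

  module _ {p q u : Level} {S : Pred Carrier p} {X : Pred Carrier q} {U : Pred Carrier u}
           {k r : ℕ} (X⊆Sᵏ : X ⊆ Pow S k) (Sʳ⁺ᵏ⊆XU : Pow S (r + k) ⊆ Mul X U) where

    Pow-⊆-Mul-Pow : ∀ n → Pow S (suc n * r + k) ⊆ Mul X (Pow U (suc n))
    Pow-⊆-Mul-Pow 0 g g∈ with Sʳ⁺ᵏ⊆XU g (Pow-cast (+-assoc r 0 k) g∈)
    ... | x , y , x∈X , y∈U , xy≈g =
      x , y , x∈X , Pow-one y∈U , xy≈g
    Pow-⊆-Mul-Pow (suc n) g g∈ with Pow-split r (Pow-cast (+-assoc r (suc n * r) k) g∈)
    ... | s , t , s∈Sʳ , t∈ , st≈g with Pow-⊆-Mul-Pow n t t∈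
    ... | x , w , x∈X , w∈Uⁿ , xw≈t with Sʳ⁺ᵏ⊆XU (s ∙ x) (Pow-∙ s∈Sʳ (X⊆Sᵏ x x∈X))
    ... | x′ , u′ , x′∈X , u′∈U , x′u′≈sx =
      x′ , u′ ∙ w , x′∈X , Pow-∙ (Pow-one u′∈U) w∈Uⁿ , (begin
        x′ ∙ (u′ ∙ w) ≈⟨ sym (assoc x′ u′ w) ⟩
        (x′ ∙ u′) ∙ w ≈⟨ ∙-congʳ x′u′≈sx ⟩
        (s ∙ x) ∙ w   ≈⟨ assoc s x w ⟩
        s ∙ (x ∙ w)   ≈⟨ ∙-congˡ xw≈t ⟩
        s ∙ t         ≈⟨ st≈g ⟩
        g             ∎)

lemma3p3 : {c ℓ p q u : Level} (G : Group c ℓ) → let open GroupSets G in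
    (k r : ℕ) → NonZero k → NonZero r →
    (S : Pred (Group.Carrier G) p) → Generates S → Symmetric S → S (Group.ε G) →
    (X : Pred (Group.Carrier G) q) (U : Pred (Group.Carrier G) u) →
    X ⊆ Pow S k →
    Pow S (r + k) ⊆ Mul X U →
    (m : ℕ) → NonZero m → Pow S (m * r + k) ⊆ Mul X (Pow U m)
lemma3p3 G k r _ _ S _ _ _ X U X⊆Sᵏ Sʳ⁺ᵏ⊆XU (suc n) _ =
  PowProperties.Pow-⊆-Mul-Pow G X⊆Sᵏ Sʳ⁺ᵏ⊆XU n
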